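{- Let $e=(\mathbf e_1,\dots,\mathbf e_{q_1})$, $f=(\mathbf f_1,\dots,\mathbf f_{q_2})$ be two disjoint sequences of nonzero vectors in $\mathbb N^d$ with $|e|=|f|$, $\Delta_{e,f}\geq0$ on $[0,1]^d$, and $\Delta_{e,f}(\mathbf x)\geq1$ for all $\mathbf x\in\mathcal D_{e,f}$. Then for every prime $p$, every $\mathbf L\in\mathcal E_{e,f}$, $\mathbf m\in\mathbb N^d$ and $s\in\mathbb N$, $$p^{s+1}g_p(\mathbf m)\big(H_{\mathbf L\cdot\mathbf mp^s}-H_{\mathbf L\cdot\lfloor\mathbf m/p\rfloor p^{s+1}}\big)\in p\mathbb Z_p.$$
   Context: $\Delta_{e,f}(\mathbf x)=\sum_i\lfloor\mathbf e_i\cdot\mathbf x\rfloor-\sum_j\lfloor\mathbf f_j\cdot\mathbf x\rfloor$; $\mathcal D_{e,f}$ is the set of $\mathbf x\in[0,1)^d$ with $\mathbf d\cdot\mathbf x\geq1$ for some $\mathbf d\in\{\mathbf e_1,\dots,\mathbf e_{q_1},\mathbf f_1,\dots,\mathbf f_{q_2}\}$; $\mathcal E_{e,f}$ is the set of $\mathbf L\in\mathbb N^d\setminus\{\mathbf 0\}$ with $\mathbf L\leq\mathbf d$ (coordinatewise) for some such $\mathbf d$. $H_n=\sum_{i=1}^n1/i$. Floor and fractional part $\{\cdot\}$ act coordinatewise on vectors. $\mu_p(\mathbf m)=\sum_{\ell\geq1}\mathbf 1_{\mathcal D_{e,f}}(\{\mathbf m/p^\ell\})$ and $g_p(\mathbf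 m)=p^{\mu_p(\mathbf m)}$. -}

module Defs where

open import Data.Nat as ℕ using (ℕ; zero; suc)
open import Data.Integer as ℤ using (ℤ; +_)
open import Data.Rational as ℚ using (ℚ; 0ℚ; 1ℚ; floor; ↥_; ↧ₙ_)
open import Data.Rational.Properties as ℚP using ()
open import Data.Fin using (Fin) renaming (zero to fzero; suc to fsuc)
open import Data.Fin.Properties using (all?)
open import Data.List using (List; []; _∷_; _++_; foldr; map)
open import Data.List.Relation.Unary.Any using (Any; any?)
open import Data.Nat.Divisibility using (_∣_)
open import Data.Product using (_×_; ∃)
open import Relation.Nullary using (¬_; Dec; does)
open import Relation.Nullary.Decidable using (_×-dec_)
open import Data.Bool using (if_then_else_)
open import Relation.Binary.PropositionalEquality using (_≡_)

Vecℕ : ℕ → Set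
Vecℕ d = Fin d → ℕ

Vecℚ : ℕ → Set
Vecℚ d = Fin d → ℚ

ΣFin : {A : Set} → (A → A → A) → A → (d : ℕ) → (Fin d → A) → A
ΣFin _⊕_ z zero    v = z
ΣFin _⊕_ z (suc d) v = v fzero ⊕ ΣFin _⊕_ z d (λ k → v (fsuc k))

dotℕ : {d : ℕ} → Vecℕ d → Vecℕ d → ℕ
dotℕ {d} u v = ΣFin ℕ._+_ 0 d (λ k → u k ℕ.* v k)

dotℚ : {d : ℕ} → Vecℕ d → Vecℚ d → ℚ
dotℚ {d} u x = ΣFin ℚ._+_ 0ℚ d (λ k → (+ u k ℚ./ 1) ℚ.* x k)

normV : {d : ℕ} → Vecℕ d → ℕ
normV {d} v = ΣFin ℕ._+_ 0 d v

normSeq : {d : ℕ} → List (Vecℕ d) → ℕ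
normSeq es = foldr (λ v n → normV v ℕ.+ n) 0 es

NonZeroVec : {d : ℕ} → Vecℕ d → Set
NonZeroVec v = ¬ (∀ k → v k ≡ 0)

DistinctVec : {d : ℕ} → Vecℕ d → Vecℕ d → Set
DistinctVec u v = ¬ (∀ k → u k ≡ v k)

Δ : {d : ℕ} → List (Vecℕ d) → List (Vecℕ d) → Vecℚ d → ℤ
Δ es fs x = sumℤ (map (λ v → floor (dotℚ v x)) es) ℤ.- sumℤ (map (λ v → floor (dotℚ v x)) fs)
  where
  sumℤ : List ℤ → ℤ
  sumℤ = foldr ℤ._+_ (+ 0)

InClosedCube : {d : ℕ} → Vecℚ d → Set
InClosedCube x = ∀ k → (0ℚ ℚ.≤ x k) × (x k ℚ.≤ 1ℚ)

InHalfOpenCube : {d : ℕ} → Vecℚ d → Set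
InHalfOpenCube x = ∀ k → (0ℚ ℚ.≤ x k) × (x k ℚ.< 1ℚ)

InD : {d : ℕ} → List (Vecℕ d) → List (Vecℕ d) → Vecℚ d → Set
InD es fs x = InHalfOpenCube x × Any (λ v → 1ℚ ℚ.≤ dotℚ v x) (es ++ fs)

InD? : {d : ℕ} → (es fs : List (Vecℕ d)) → (x : Vecℚ d) → Dec (InD es fs x)
InD? es fs x =
  all? (λ k → (0ℚ ℚP.≤? x k) ×-dec (x k ℚP.<? 1ℚ))
  ×-dec any? (λ v → 1ℚ ℚP.≤? dotℚ v x) (es ++ fs)

InE : {d : ℕ} → List (Vecℕ d) → List (Vecℕ d) → Vecℕ d → Set
InE es fs L = NonZeroVec L × Any (λ v → ∀ k → L k ℕ.≤ v k) (es ++ fs)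

frac : ℚ → ℚ
frac x = x ℚ.- (floor x ℚ./ 1)

-- the rational m / n  (n ≥ 1; the value at n = 0 is a junk 0 and never used)
_/ℚ_ : ℕ → ℕ → ℚ
m /ℚ zero  = 0ℚ
m /ℚ suc n = + m ℚ./ suc n

-- floor division ⌊m / n⌋ (n ≥ 1; junk value 0 at n = 0, never used)
_/ℕ_ : ℕ → ℕ → ℕ
m /ℕ zero  = 0
m /ℕ suc n = m ℕ./ suc n

fracVec : {d : ℕ} → Vecℕ d → ℕ → ℕ → Vecℚ d
fracVec m p ℓ k = frac (m k /ℚ (p ℕ.^ ℓ))

indD : {d : ℕ} → List (Vecℕ d) → List (Vecℕ d) → Vecℕ d → ℕ → ℕ → ℕ
indD es fs m p ℓ = if does (InD? es fs (fracVec m p ℓ)) then 1 else 0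

-- μ_p(m) = Σ_{ℓ ≥ 1} 1_𝒟({m/p^ℓ}).  The series is a finite sum: for p ≥ 2 and
-- ℓ > B := Σ_k m_k + Σ_{v ∈ e ++ f} v·m we have p^ℓ > B, hence {m/p^ℓ} = m/p^ℓ
-- and v·{m/p^ℓ} < 1 for all v, so the term vanishes.
muBound : {d : ℕ} → List (Vecℕ d) → List (Vecℕ d) → Vecℕ d → ℕ
muBound es fs m = normV m ℕ.+ foldr (λ v n → dotℕ v m ℕ.+ n) 0 (es ++ fs)

sumRange : (ℕ → ℕ) → ℕ → ℕ
sumRange t zero    = 0
sumRange t (suc n) = sumRange t n ℕ.+ t (suc n)

μ : {d : ℕ} → List (Vecℕ d) → List (Vecℕ d) → ℕ → Vecℕ d → ℕ
μ es fs p m = sumRange (indD es fs m p) (muBound es fs m)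

g : {d : ℕ} → List (Vecℕ d) → List (Vecℕ d) → ℕ → Vecℕ d → ℕ
g es fs p m = p ℕ.^ μ es fs p m

H : ℕ → ℚ
H zero    = 0ℚ
H (suc n) = H n ℚ.+ (+ 1 ℚ./ suc n)

-- r ∈ pℤ_p for a rational r: in lowest terms, p divides the numerator and
-- does not divide the denominator (i.e. v_p(r) ≥ 1, with 0 ∈ pℤ_p).
InPZp : ℕ → ℚ → Set
InPZp p r = (p ∣ ℤ.∣ ↥ r ∣) × ¬ (p ∣ ↧ₙ r)

module Submission where

-- H_N − H_M is the sum of 1/j over the window M < j ≤ N, so it suffices that
-- every term p^{s+1} p^{μ_p(m)} / j lies in pℤ_(p), i.e. that v_p(j) ≤ s + μ_p(m).
-- If p^{s+ℓ} divides a window index j with ℓ ≥ 1, comparing j with M and N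
-- shows that the digits of m modulo p^ℓ carry: L·(m mod p^ℓ) ≥ p^ℓ.  For
-- the vector v ∈ e ++ f dominating L this gives v·{m/p^ℓ} ≥ 1, so
-- {m/p^ℓ} ∈ 𝒟_{e,f}; hence v_p(j) = s + t forces t terms of the series μ_p(m)
-- to equal 1.

open import Defs
open import Data.Nat as ℕ
  using (ℕ; zero; suc; _+_; _*_; _^_; _∸_; _≤_; _<_; z≤n; s≤s; NonZero)
open import Data.Nat.Properties
open import Data.Nat.DivMod as ℕDM using (_/_; _%_)
open import Data.Nat.Divisibility as ℕDiv using (_∣_; _∣?_; ∣-trans; divides)
open import Data.Nat.Primality using (Prime; euclidsLemma; prime⇒nonZero; prime⇒nonTrivial)
open import Data.Nat.Coprimality as Coprime using (coprime?; coprime-divisor)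
open import Data.Nat.GCD using (gcd)
open import Data.Nat.Induction using (<-rec)
open import Data.Nat.Tactic.RingSolver as ℕSolver using ()
open import Data.Integer as ℤ using (ℤ; +_; -[1+_]; +≤+; +<+)
open import Data.Integer.Properties as ℤP using (pos-*; pos-+)
open import Data.Integer.DivMod as ℤDM using ()
open import Data.Integer.Tactic.RingSolver as ℤSolver using ()
open import Data.Rational as ℚ using (ℚ; mkℚ; 0ℚ; 1ℚ; floor; toℚᵘ)
open import Data.Rational.Properties as ℚP
  using (toℚᵘ-homo-+; toℚᵘ-homo-*; toℚᵘ-homo‿-; toℚᵘ-fromℚᵘ; toℚᵘ-cancel-≤; toℚᵘ-cancel-<)
open import Data.Rational.Unnormalised as ℚᵘ using (mkℚᵘ; *≡*; *≤*; *<*)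
open import Data.Rational.Unnormalised.Properties as ℚᵘP using (≃-trans; ≃-sym)
open import Data.Fin using (Fin) renaming (zero to fzero; suc to fsuc)
open import Data.List using (List; _∷_; _++_; foldr)
open import Data.List.Relation.Unary.All using (All)
open import Data.List.Relation.Unary.Any as Any using (Any; here; there)
open import Data.List.Membership.Propositional using (_∈_)
open import Data.Product using (Σ; _×_; _,_; proj₁; proj₂)
open import Data.Sum using (inj₁; inj₂)
open import Data.Bool using (if_then_else_)
open import Relation.Nullary using (¬_; Dec; yes; no; does; contradiction)
open import Relation.Nullary.Decidable using (recompute)
open import Relation.Binary.PropositionalEquality

_≐_/1+_ : ℚ → ℕ → ℕ → Set
r ≐ a /1+ n = toℚᵘ r ℚᵘ.≃ mkℚᵘ (+ a) n

≐-/ : ∀ a n → (+ a ℚ./ suc n) ≐ a /1+ n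
≐-/ a n = toℚᵘ-fromℚᵘ (mkℚᵘ (+ a) n)

≐-rescale : ∀ {r a n b k} → r ≐ a /1+ n → a * suc k ≡ b * suc n → r ≐ b /1+ k
≐-rescale {a = a} {n} {b} {k} r≐ cross =
  ≃-trans r≐ (*≡* (trans (sym (pos-* a (suc k))) (trans (cong +_ cross) (pos-* b (suc n)))))

≐-+ : ∀ {r r' a a' n n'} → r ≐ a /1+ n → r' ≐ a' /1+ n' →
  (r ℚ.+ r') ≐ (a * suc n' + a' * suc n) /1+ (n' + n * suc n')
≐-+ {r} {r'} {a} {a'} {n} {n'} r≐ r'≐ =
  ≃-trans (toℚᵘ-homo-+ r r') (≃-trans (ℚᵘP.+-cong r≐ r'≐) (*≡* (cong (ℤ._* + suc (n' + n * suc n'))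
    (trans (cong₂ ℤ._+_ (sym (pos-* a (suc n'))) (sym (pos-* a' (suc n)))) (sym (pos-+ (a * suc n') _))))))

≐-* : ∀ {r r' a a' n n'} → r ≐ a /1+ n → r' ≐ a' /1+ n' →
  (r ℚ.* r') ≐ (a * a') /1+ (n' + n * suc n')
≐-* {r} {r'} {a} {a'} {n} {n'} r≐ r'≐ =
  ≃-trans (toℚᵘ-homo-* r r') (≃-trans (ℚᵘP.*-cong r≐ r'≐) (*≡* (cong (ℤ._* + suc (n' + n * suc n'))
    (sym (pos-* a a')))))

≐-nonNeg : ∀ {r a n} → r ≐ a /1+ n → 0ℚ ℚ.≤ r
≐-nonNeg {a = a} {n} r≐ = toℚᵘ-cancel-≤ (ℚᵘP.≤-respʳ-≃ (≃-sym r≐)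
  (*≤* (subst₂ ℤ._≤_ (sym (ℤP.*-zeroˡ (+ suc n))) (sym (ℤP.*-identityʳ (+ a))) (+≤+ z≤n))))

≐-<1 : ∀ {r a n} → r ≐ a /1+ n → a < suc n → r ℚ.< 1ℚ
≐-<1 {n = n} r≐ a<1+n = toℚᵘ-cancel-< (ℚᵘP.<-respˡ-≃ (≃-sym r≐)
  (*<* (subst₂ ℤ._<_ (sym (ℤP.*-identityʳ (+ _))) (sym (ℤP.*-identityˡ (+ suc n))) (+<+ a<1+n))))

≐-≥1 : ∀ {r a n} → r ≐ a /1+ n → suc n ≤ a → 1ℚ ℚ.≤ r
≐-≥1 {n = n} r≐ 1+n≤a = toℚᵘ-cancel-≤ (ℚᵘP.≤-respʳ-≃ (≃-sym r≐)
  (*≤* (subst₂ ℤ._≤_ (sym (ℤP.*-identityˡ (+ suc n))) (sym (ℤP.*-identityʳ (+ _))) (+≤+ 1+n≤a))))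

-- The
-- normalised fraction is m / (1 + n) with numerator and denominator divided
-- by their gcd, which does not change the quotient.
floor-/ : ∀ m n → floor (+ m ℚ./ suc n) ≡ + (m / suc n)
floor-/ m n = quotient (+ m ℚ./ suc n) (gcd m (suc n)) (ℚP.↥-/ (+ m) (suc n)) (ℚP.↧-/ (+ m) (suc n))
  where
  quotient : (q : ℚ) (c : ℕ) → ℚ.↥ q ℤ.* + c ≡ + m → ℚ.↧ q ℤ.* + c ≡ + suc n →
             floor q ≡ + (m / suc n)
  quotient (mkℚ _ b _) zero _ den≡ with () ← trans (sym (ℤP.*-zeroʳ (+ suc b))) den≡
  quotient (mkℚ -[1+ _ ] _ _) (suc c) () _
  quotient (mkℚ (+ a) b _) (suc c) num≡ den≡ =
    trans (ℤDM.div-pos-is-/ℕ (+ a) (suc b)) (cong +_ (begin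
      a / suc b                         ≡⟨ ℕDM.m*n/o*n≡m/o a (suc c) (suc b) ⟨
      (a * suc c) / (suc b * suc c)     ≡⟨ ℕDM./-congˡ (ℤP.+-injective (trans (pos-* a (suc c)) num≡)) ⟩
      m / (suc b * suc c)               ≡⟨ ℕDM./-congʳ {m = m} (ℤP.+-injective den≡) ⟩
      m / suc n                         ∎))
    where open ≡-Reasoning

frac-/ : ∀ m n → frac (m /ℚ suc n) ≐ (m % suc n) /1+ n
frac-/ m n rewrite floor-/ m n =
  ≃-trans (toℚᵘ-homo-+ x (ℚ.- y))
    (≃-trans (ℚᵘP.+-cong (≐-/ m n) (≃-trans (toℚᵘ-homo‿- y) (ℚᵘP.-‿cong (≐-/ q 0))))
      (*≡* cross))
  where
  x = + m ℚ./ suc n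
  q = m / suc n
  r = m % suc n
  y = + q ℚ./ 1
  -- m / (1+n) − q = (m − q (1+n)) / (1+n), and m − q (1+n) = r.
  identity : ∀ (r q k : ℤ) → ((r ℤ.+ q ℤ.* k) ℤ.* + 1 ℤ.+ (ℤ.- q) ℤ.* k) ℤ.* k ≡ r ℤ.* (k ℤ.* + 1)
  identity = ℤSolver.solve-∀
  cross : (+ m ℤ.* + 1 ℤ.+ (ℤ.- + q) ℤ.* + suc n) ℤ.* + suc n ≡ + r ℤ.* + (suc n * 1)
  cross = begin
    (+ m ℤ.* + 1 ℤ.+ (ℤ.- + q) ℤ.* + suc n) ℤ.* + suc n
      ≡⟨ cong (λ z → (z ℤ.* + 1 ℤ.+ (ℤ.- + q) ℤ.* + suc n) ℤ.* + suc n) (ℤDM.a≡a%ℕn+[a/ℕn]*n (+ m) (suc n)) ⟩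
    ((+ r ℤ.+ + q ℤ.* + suc n) ℤ.* + 1 ℤ.+ (ℤ.- + q) ℤ.* + suc n) ℤ.* + suc n
      ≡⟨ identity (+ r) (+ q) (+ suc n) ⟩
    + r ℤ.* (+ suc n ℤ.* + 1)
      ≡⟨ cong (+ r ℤ.*_) (pos-* (suc n) 1) ⟨
    + r ℤ.* + (suc n * 1) ∎
    where open ≡-Reasoning

≐-dot : ∀ {d} (v : Vecℕ d) (x : Vecℚ d) (a : Vecℕ d) n →
  (∀ k → x k ≐ a k /1+ n) → dotℚ v x ≐ dotℕ v a /1+ n
≐-dot {zero} v x a n x≐ = *≡* refl
≐-dot {suc d} v x a n x≐ =
  ≐-rescale (≐-+ (≐-* (≐-/ (v fzero) 0) (x≐ fzero)) (≐-dot (tail v) (tail x) (tail a) n (tail x≐)))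
            (identity (v fzero * a fzero) (dotℕ (tail v) (tail a)) n)
  where
  tail : ∀ {A : Fin (suc d) → Set} → ((k : Fin (suc d)) → A k) → (k : Fin d) → A (fsuc k)
  tail w k = w (fsuc k)
  identity : ∀ a S n → (a * suc n + S * suc (n + 0 * suc n)) * suc n
                     ≡ (a + S) * suc (n + (n + 0 * suc n) * suc n)
  identity = ℕSolver.solve-∀

-- r is p times a p-integral rational: r = a / (1 + n) with p ∣ a and p ∤ 1 + n.
-- Unlike InPZp this is not tied to lowest terms, which makes it closed under
-- addition by a direct computation.
PMultiple : ℕ → ℚ → Set
PMultiple p r = Σ ℕ λ a → Σ ℕ λ n → (p ∣ a) × (¬ p ∣ suc n) × r ≐ a /1+ n

prime∤1 : ∀ {p} → Prime p → ¬ p ∣ 1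
prime∤1 pp p∣1 with ℕDiv.∣1⇒≡1 p∣1
... | refl with () ← prime⇒nonTrivial pp

pMultiple-0 : ∀ {p} → Prime p → PMultiple p 0ℚ
pMultiple-0 pp = 0 , 0 , ℕDiv._∣0 _ , prime∤1 pp , *≡* refl

pMultiple-+ : ∀ {p r r'} → Prime p → PMultiple p r → PMultiple p r' → PMultiple p (r ℚ.+ r')
pMultiple-+ pp (a , n , p∣a , p∤n , r≐) (a' , n' , p∣a' , p∤n' , r'≐) =
  _ , _ ,
  ℕDiv.∣m∣n⇒∣m+n (∣-trans p∣a (ℕDiv.m∣m*n (suc n'))) (∣-trans p∣a' (ℕDiv.m∣m*n (suc n))) ,
  p∤product ,
  ≐-+ r≐ r'≐
  where
  p∤product : ¬ _ ∣ suc n * suc n'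
  p∤product p∣nn' with euclidsLemma (suc n) (suc n') pp p∣nn'
  ... | inj₁ p∣n  = p∤n p∣n
  ... | inj₂ p∣n' = p∤n' p∣n'

pMultiple-quot : ∀ {p} c i u k → ¬ p ∣ suc u → c * suc u ≡ p * k * suc i →
  PMultiple p ((+ c ℚ./ 1) ℚ.* (+ 1 ℚ./ suc i))
pMultiple-quot {p} c i u k p∤u cross =
  p * k , u , ℕDiv.m∣m*n k , p∤u ,
  ≐-rescale (≐-* (≐-/ c 0) (≐-/ 1 i))
    (trans (cong (_* suc u) (*-identityʳ c)) (trans cross (cong (λ z → p * k * suc z) (sym (+-identityʳ i)))))

-- PMultiple implies membership in pℤ_p in the sense of lowest terms: the
-- numerator inherits p from a and the denominator divides 1 + n.
pMultiple⇒InPZp : ∀ {p r} → Prime p → PMultiple p r → InPZp p r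
pMultiple⇒InPZp {p} {mkℚ num den coprime} pp (a , n , p∣a , p∤n , *≡* eq) = p∣num , p∤den
  where
  cross : ℤ.∣ num ∣ * suc n ≡ a * suc den
  cross = trans (sym (ℤP.abs-* num (+ suc n))) (trans (cong ℤ.∣_∣ eq) (ℤP.abs-* (+ a) (+ suc den)))
  p∣num : p ∣ ℤ.∣ num ∣
  p∣num with euclidsLemma ℤ.∣ num ∣ (suc n) pp
               (subst (p ∣_) (sym cross) (∣-trans p∣a (ℕDiv.m∣m*n (suc den))))
  ... | inj₁ p∣num = p∣num
  ... | inj₂ p∣n   = contradiction p∣n p∤n
  den∣n : suc den ∣ suc n
  den∣n = coprime-divisor (Coprime.sym (recompute (coprime? _ _) coprime))
                          (subst (suc den ∣_) (sym cross) (ℕDiv.n∣m*n a))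
  p∤den : ¬ p ∣ suc den
  p∤den p∣den = p∤n (∣-trans p∣den den∣n)

*-telescope : ∀ c a b h → c ℚ.* ((a ℚ.+ b) ℚ.- h) ≡ c ℚ.* (a ℚ.- h) ℚ.+ c ℚ.* b
*-telescope c a b h = trans (cong (c ℚ.*_) (begin
    (a ℚ.+ b) ℚ.- h     ≡⟨ ℚP.+-assoc a b (ℚ.- h) ⟩
    a ℚ.+ (b ℚ.- h)     ≡⟨ cong (a ℚ.+_) (ℚP.+-comm b (ℚ.- h)) ⟩
    a ℚ.+ (ℚ.- h ℚ.+ b) ≡⟨ ℚP.+-assoc a (ℚ.- h) b ⟨
    (a ℚ.- h) ℚ.+ b     ∎)) (ℚP.*-distribˡ-+ c (a ℚ.- h) b)
  where open ≡-Reasoning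

pMultiple-harmonic : ∀ {p} → Prime p → ∀ (c : ℚ) M t →
  (∀ i → M ≤ i → i < M + t → PMultiple p (c ℚ.* (+ 1 ℚ./ suc i))) →
  PMultiple p (c ℚ.* (H (M + t) ℚ.- H M))
pMultiple-harmonic pp c M zero terms
  rewrite +-identityʳ M | ℚP.+-inverseʳ (H M) | ℚP.*-zeroʳ c = pMultiple-0 pp
pMultiple-harmonic pp c M (suc t) terms
  rewrite +-suc M t | *-telescope c (H (M + t)) (+ 1 ℚ./ suc (M + t)) (H M) =
  pMultiple-+ pp (pMultiple-harmonic pp c M t (λ i M≤i i<M+t → terms i M≤i (m<n⇒m<1+n i<M+t)))
                 (terms (M + t) (m≤m+n M t) ≤-refl)

dot-mono : ∀ {d} {a b x y : Vecℕ d} → (∀ k → a k ≤ b k) → (∀ k → x k ≤ y k) → dotℕ a x ≤ dotℕ b y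
dot-mono {zero}  a≤b x≤y = z≤n
dot-mono {suc d} a≤b x≤y =
  +-mono-≤ (*-mono-≤ (a≤b fzero) (x≤y fzero)) (dot-mono (λ k → a≤b (fsuc k)) (λ k → x≤y (fsuc k)))

dot-+ : ∀ {d} (a x y : Vecℕ d) → dotℕ a (λ k → x k + y k) ≡ dotℕ a x + dotℕ a y
dot-+ {zero}  a x y = refl
dot-+ {suc d} a x y =
  trans (cong (_+_ (a fzero * (x fzero + y fzero))) (dot-+ (λ k → a (fsuc k)) (λ k → x (fsuc k)) (λ k → y (fsuc k))))
        (identity (a fzero) (x fzero) (y fzero) _ _)
  where
  identity : ∀ a x y X Y → a * (x + y) + (X + Y) ≡ (a * x + X) + (a * y + Y)
  identity = ℕSolver.solve-∀

dot-scale : ∀ {d} (a x : Vecℕ d) c → dotℕ a (λ k → c * x k) ≡ c * dotℕ a x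
dot-scale {zero}  a x c = sym (*-zeroʳ c)
dot-scale {suc d} a x c =
  trans (cong (_+_ (a fzero * (c * x fzero))) (dot-scale (λ k → a (fsuc k)) (λ k → x (fsuc k)) c))
        (identity (a fzero) (x fzero) c _)
  where
  identity : ∀ a x c D → a * (c * x) + c * D ≡ c * (a * x + D)
  identity = ℕSolver.solve-∀

dot-congʳ : ∀ {d} (a : Vecℕ d) {x y : Vecℕ d} → (∀ k → x k ≡ y k) → dotℕ a x ≡ dotℕ a y
dot-congʳ {zero}  a x≡y = refl
dot-congʳ {suc d} a x≡y = cong₂ _+_ (cong (a fzero *_) (x≡y fzero)) (dot-congʳ (λ k → a (fsuc k)) (λ k → x≡y (fsuc k)))

dot-divMod : ∀ {d} (a m : Vecℕ d) q .{{_ : NonZero q}} →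
  dotℕ a m ≡ dotℕ a (λ k → m k % q) + q * dotℕ a (λ k → m k / q)
dot-divMod a m q = begin
  dotℕ a m                                              ≡⟨ dot-congʳ a split ⟩
  dotℕ a (λ k → m k % q + q * (m k / q))                ≡⟨ dot-+ a _ _ ⟩
  dotℕ a (λ k → m k % q) + dotℕ a (λ k → q * (m k / q)) ≡⟨ cong (_+_ (dotℕ a (λ k → m k % q))) (dot-scale a _ q) ⟩
  dotℕ a (λ k → m k % q) + q * dotℕ a (λ k → m k / q)   ∎
  where
  open ≡-Reasoning
  split : ∀ k → m k ≡ m k % q + q * (m k / q)
  split k = trans (ℕDM.m≡m%n+[m/n]*n (m k) q) (cong (_+_ (m k % q)) (*-comm (m k / q) q))

sumRange-ones : ∀ (f : ℕ → ℕ) t → (∀ ℓ → 1 ≤ ℓ → ℓ ≤ t → f ℓ ≡ 1) → sumRange f t ≡ t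
sumRange-ones f zero    ones = refl
sumRange-ones f (suc t) ones =
  trans (cong₂ _+_ (sumRange-ones f t (λ ℓ 1≤ℓ ℓ≤t → ones ℓ 1≤ℓ (m≤n⇒m≤1+n ℓ≤t))) (ones (suc t) (s≤s z≤n) ≤-refl))
        (+-comm t 1)

sumRange-mono : ∀ (f : ℕ → ℕ) {a b} → a ≤ b → sumRange f a ≤ sumRange f b
sumRange-mono f {b = zero}  z≤n = ≤-refl
sumRange-mono f {b = suc b} a≤1+b with m≤n⇒m<n∨m≡n a≤1+b
... | inj₁ a<1+b = ≤-trans (sumRange-mono f (ℕ.s≤s⁻¹ a<1+b)) (m≤m+n _ _)
... | inj₂ refl  = ≤-refl

sumRange-≥ : ∀ (f : ℕ → ℕ) {t B} → t ≤ B → (∀ ℓ → 1 ≤ ℓ → ℓ ≤ t → f ℓ ≡ 1) → t ≤ sumRange f B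
sumRange-≥ f {t} {B} t≤B ones = subst (_≤ sumRange f B) (sumRange-ones f t ones) (sumRange-mono f t≤B)

n<P^n : ∀ P → 1 < P → ∀ n → n < P ^ n
n<P^n P 1<P zero    = s≤s z≤n
n<P^n P 1<P (suc n) = begin-strict
  suc n         ≡⟨ *-identityˡ (suc n) ⟨
  1 * suc n     <⟨ *-monoˡ-< (suc n) 1<P ⟩
  P * suc n     ≤⟨ *-monoʳ-≤ P (n<P^n P 1<P n) ⟩
  P * P ^ n     ∎
  where open ≤-Reasoning

Factorisation : ℕ → ℕ → Set
Factorisation P i = Σ ℕ λ v → Σ ℕ λ u → (suc i ≡ P ^ v * suc u) × ¬ P ∣ suc u

factorise : ∀ P → 1 < P → ∀ i → Factorisation P i
factorise P 1<P = <-rec (Factorisation P) divideOut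
  where
  divideOut : ∀ i → (∀ {j} → j < i → Factorisation P j) → Factorisation P i
  divideOut i rec with P ∣? suc i
  ... | no P∤1+i = 0 , i , sym (+-identityʳ (suc i)) , P∤1+i
  ... | yes (divides (suc q) 1+i≡) with rec q<i
    where
    q<i : q < i
    q<i = ℕ.s≤s⁻¹ (subst (suc q <_) (sym 1+i≡)
            (subst (_< suc q * P) (*-identityʳ (suc q)) (*-monoʳ-< (suc q) 1<P)))
  ... | v , u , 1+q≡ , P∤1+u =
    suc v , u , trans 1+i≡ (trans (cong (_* P) 1+q≡) (reassociate (P ^ v) (suc u) P)) , P∤1+u
    where
    reassociate : ∀ a b P → a * b * P ≡ P * a * b
    reassociate = ℕSolver.solve-∀

carry : ∀ {d} (a m : Vecℕ d) q .{{_ : NonZero q}} j →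
  q * j ≤ dotℕ a m → dotℕ a (λ k → m k / q) < j → q ≤ dotℕ a (λ k → m k % q)
carry a m q j qj≤a·m a·⌊m/q⌋<j = +-cancelʳ-≤ (q * a·⌊m/q⌋) q _ (begin
  q + q * a·⌊m/q⌋                        ≡⟨ *-suc q a·⌊m/q⌋ ⟨
  q * suc a·⌊m/q⌋                        ≤⟨ *-monoʳ-≤ q a·⌊m/q⌋<j ⟩
  q * j                                   ≤⟨ qj≤a·m ⟩
  dotℕ a m                                ≡⟨ dot-divMod a m q ⟩
  dotℕ a (λ k → m k % q) + q * a·⌊m/q⌋   ∎)
  where
  open ≤-Reasoning
  a·⌊m/q⌋ = dotℕ a (λ k → m k / q)

dot-floor-iterate : ∀ {d} (a m : Vecℕ d) P Q
  .{{_ : NonZero P}} .{{_ : NonZero Q}} .{{_ : NonZero (P * Q)}} →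
  Q * dotℕ a (λ k → m k / (P * Q)) ≤ dotℕ a (λ k → m k / P)
dot-floor-iterate a m P Q = begin
  Q * dotℕ a (λ k → m k / (P * Q))    ≡⟨ dot-scale a _ Q ⟨
  dotℕ a (λ k → Q * (m k / (P * Q)))  ≤⟨ dot-mono {a = a} (λ k → ≤-refl) pointwise ⟩
  dotℕ a (λ k → m k / P)               ∎
  where
  open ≤-Reasoning
  pointwise : ∀ k → Q * (m k / (P * Q)) ≤ m k / P
  pointwise k = begin
    Q * (m k / (P * Q))    ≡⟨ cong (Q *_) (ℕDM.m/n/o≡m/[n*o] (m k) P Q) ⟨
    Q * (m k / P / Q)      ≡⟨ *-comm Q _ ⟩
    (m k / P / Q) * Q      ≤⟨ ℕDM.m/n*n≤m (m k / P) Q ⟩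
    m k / P                ∎

-- The harmonic window of the theorem runs over (M, N] with
-- N = (L·m) P^s and M = (L·⌊m/P⌋) P^{s+1}.  An index j in this window that is
-- divisible by P^{s+1+ℓ} forces a carry in base P^{1+ℓ}.
window-carry : ∀ {d} (L m : Vecℕ d) P .{{_ : NonZero P}} s ℓ .{{_ : NonZero (P ^ suc ℓ)}} j →
  P ^ (s + suc ℓ) ∣ j → dotℕ L (λ k → m k / P) * P ^ suc s < j → j ≤ dotℕ L m * P ^ s →
  P ^ suc ℓ ≤ dotℕ L (λ k → m k % P ^ suc ℓ)
window-carry L m P s ℓ j (divides c j≡) M<j j≤N =
  carry L m (P ^ suc ℓ) c
    (*-cancelʳ-≤ _ _ (P ^ s) (subst (_≤ dotℕ L m * P ^ s) (trans j≡ (split-power s (suc ℓ))) j≤N))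
    (*-cancelˡ-< (P ^ ℓ) _ _ (≤-<-trans (dot-floor-iterate L m P (P ^ ℓ))
      (*-cancelʳ-< (P ^ suc s) _ _ (subst (dotℕ L (λ k → m k / P) * P ^ suc s <_)
        (trans j≡ (trans (cong (λ n → c * P ^ n) (+-suc s ℓ)) (split-power (suc s) ℓ))) M<j))))
  where
  instance
    P^s≢0 : NonZero (P ^ s)
    P^s≢0 = m^n≢0 P s
    P^ℓ≢0 : NonZero (P ^ ℓ)
    P^ℓ≢0 = m^n≢0 P ℓ
  split-power : ∀ a b → c * P ^ (a + b) ≡ P ^ b * c * P ^ a
  split-power a b = trans (cong (c *_) (^-distribˡ-+-* P a b)) (commute c (P ^ a) (P ^ b))
    where
    commute : ∀ c x y → c * (x * y) ≡ y * c * x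
    commute = ℕSolver.solve-∀

dominated-≤-sum : ∀ {d} (L m : Vecℕ d) (vs : List (Vecℕ d)) →
  Any (λ v → ∀ k → L k ≤ v k) vs → dotℕ L m ≤ foldr (λ v n → dotℕ v m + n) 0 vs
dominated-≤-sum L m (v ∷ vs) (here L≤v)   = ≤-trans (dot-mono L≤v (λ k → ≤-refl)) (m≤m+n _ _)
dominated-≤-sum L m (v ∷ vs) (there rest) = ≤-trans (dominated-≤-sum L m vs rest) (m≤n+m _ _)

-- A carry in base q at a vector L ∈ ℰ_{e,f} puts {m/q} into 𝒟_{e,f}: each
-- {m_k/q} = (m_k mod q)/q lies in [0,1), and for the v ∈ e ++ f dominating L,
-- v·{m/q} ≥ L·(m mod q)/q ≥ 1.
carry⇒InD : ∀ {d} (e f : List (Vecℕ d)) (L m : Vecℕ d) q .{{_ : NonZero q}} → InE e f L →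
  q ≤ dotℕ L (λ k → m k % q) → InD e f (λ k → frac (m k /ℚ q))
carry⇒InD e f L m (suc n) (_ , dominated) carried = inCube , Any.map atLeastOne dominated
  where
  inCube : InHalfOpenCube (λ k → frac (m k /ℚ suc n))
  inCube k = ≐-nonNeg (frac-/ (m k) n) , ≐-<1 (frac-/ (m k) n) (ℕDM.m%n<n (m k) (suc n))
  atLeastOne : ∀ {v} → (∀ k → L k ≤ v k) → 1ℚ ℚ.≤ dotℚ v (λ k → frac (m k /ℚ suc n))
  atLeastOne {v} L≤v = ≐-≥1 (≐-dot v _ (λ k → m k % suc n) n (λ k → frac-/ (m k) n))
                            (≤-trans carried (dot-mono L≤v (λ k → ≤-refl)))

carry-≤-muBound : ∀ {d} (e f : List (Vecℕ d)) (L m : Vecℕ d) q .{{_ : NonZero q}} → InE e f L →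
  dotℕ L (λ k → m k % q) ≤ muBound e f m
carry-≤-muBound e f L m q (_ , dominated) =
  ≤-trans (dot-mono {a = L} (λ k → ≤-refl) (λ k → ℕDM.m%n≤m (m k) q))
          (≤-trans (dominated-≤-sum L m (e ++ f) dominated) (m≤n+m _ _))

indicator-1 : ∀ {A : Set} (D : Dec A) → A → (if does D then 1 else 0) ≡ 1
indicator-1 (yes _) a = refl
indicator-1 (no ¬a) a = contradiction a ¬a

InD⇒μ≥ : ∀ {d} (e f : List (Vecℕ d)) P (m : Vecℕ d) t → t ≤ muBound e f m →
  (∀ ℓ → 1 ≤ ℓ → ℓ ≤ t → InD e f (fracVec m P ℓ)) → t ≤ μ e f P m
InD⇒μ≥ e f P m t t≤bound inD =
  sumRange-≥ (indD e f m P) t≤bound (λ ℓ 1≤ℓ ℓ≤t → indicator-1 (InD? e f (fracVec m P ℓ)) (inD ℓ 1≤ℓ ℓ≤t))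

^-∣-^ : ∀ P {a b} → a ≤ b → P ^ a ∣ P ^ b
^-∣-^ P {a} a≤b with m≤n⇒∃[o]m+o≡n a≤b
... | o , refl = subst (P ^ a ∣_) (sym (^-distribˡ-+-* P a o)) (ℕDiv.m∣m*n (P ^ o))

-- A number c = P^{1+e} divided by 1 + i = P^v (1 + u) with P ∤ 1 + u and
-- v ≤ e is a P-multiple: it equals P · P^{e−v} / (1 + u).
pMultiple-power-quot : ∀ {P} c e i v u → c ≡ P ^ suc e →
  suc i ≡ P ^ v * suc u → ¬ P ∣ suc u → v ≤ e → PMultiple P ((+ c ℚ./ 1) ℚ.* (+ 1 ℚ./ suc i))
pMultiple-power-quot {P} c e i v u refl 1+i≡ P∤1+u v≤e = pMultiple-quot c i u (P ^ (e ∸ v)) P∤1+u (begin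
  P * P ^ e * suc u                          ≡⟨ cong (λ n → P * P ^ n * suc u) (m∸n+n≡m v≤e) ⟨
  P * P ^ (e ∸ v + v) * suc u                ≡⟨ cong (λ x → P * x * suc u) (^-distribˡ-+-* P (e ∸ v) v) ⟩
  P * (P ^ (e ∸ v) * P ^ v) * suc u          ≡⟨ reassociate P (P ^ (e ∸ v)) (P ^ v) (suc u) ⟩
  P * P ^ (e ∸ v) * (P ^ v * suc u)          ≡⟨ cong (P * P ^ (e ∸ v) *_) 1+i≡ ⟨
  P * P ^ (e ∸ v) * suc i                    ∎)
  where
  open ≡-Reasoning
  reassociate : ∀ a b c x → a * (b * c) * x ≡ a * b * (c * x)
  reassociate = ℕSolver.solve-∀

/ℕ-is-/ : ∀ m n .{{_ : NonZero n}} → m /ℕ n ≡ m / n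
/ℕ-is-/ m (suc n) = refl

module Window {d} (e f : List (Vecℕ d)) (L : Vecℕ d) (L∈E : InE e f L)
              (P : ℕ) (P-prime : Prime P) (m : Vecℕ d) (s : ℕ) where

  instance
    P≢0 : NonZero P
    P≢0 = prime⇒nonZero P-prime

  1<P : 1 < P
  1<P = ℕ.nonTrivial⇒n>1 P {{prime⇒nonTrivial P-prime}}

  N M : ℕ
  N = dotℕ L m * P ^ s
  M = dotℕ L (λ k → m k / P) * P ^ suc s

  M≤N : M ≤ N
  M≤N = begin
    L·⌊m/P⌋ * (P * P ^ s)   ≡⟨ *-assoc L·⌊m/P⌋ P (P ^ s) ⟨
    L·⌊m/P⌋ * P * P ^ s     ≤⟨ *-monoˡ-≤ (P ^ s) (subst (_≤ dotℕ L m) (*-comm P L·⌊m/P⌋) P·L·⌊m/P⌋≤L·m) ⟩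
    dotℕ L m * P ^ s        ∎
    where
    open ≤-Reasoning
    L·⌊m/P⌋ = dotℕ L (λ k → m k / P)
    P·L·⌊m/P⌋≤L·m : P * L·⌊m/P⌋ ≤ dotℕ L m
    P·L·⌊m/P⌋≤L·m = subst (P * L·⌊m/P⌋ ≤_) (sym (dot-divMod L m P)) (m≤n+m _ _)

  carry-at : ∀ ℓ j → P ^ (s + suc ℓ) ∣ j → M < j → j ≤ N →
    InD e f (fracVec m P (suc ℓ)) × (P ^ suc ℓ ≤ muBound e f m)
  carry-at ℓ j P^[s+1+ℓ]∣j M<j j≤N =
    carry⇒InD e f L m (P ^ suc ℓ) L∈E carried , ≤-trans carried (carry-≤-muBound e f L m (P ^ suc ℓ) L∈E)
    where
    instance
      P^[1+ℓ]≢0 : NonZero (P ^ suc ℓ)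
      P^[1+ℓ]≢0 = m^n≢0 P (suc ℓ)
    carried : P ^ suc ℓ ≤ dotℕ L (λ k → m k % P ^ suc ℓ)
    carried = window-carry L m P s ℓ j P^[s+1+ℓ]∣j M<j j≤N

  valuation-bound : ∀ v j → P ^ v ∣ j → M < j → j ≤ N → v ≤ s + μ e f P m
  valuation-bound v j P^v∣j M<j j≤N with ≤-total v s
  ... | inj₁ v≤s = ≤-trans v≤s (m≤m+n s _)
  ... | inj₂ s≤v = subst (_≤ s + μ e f P m) (m+[n∸m]≡n s≤v)
                     (+-monoʳ-≤ s (InD⇒μ≥ e f P m (v ∸ s) (below-bound (v ∸ s) ≤-refl) inD))
    where
    carry-below : ∀ ℓ → suc ℓ ≤ v ∸ s → InD e f (fracVec m P (suc ℓ)) × (P ^ suc ℓ ≤ muBound e f m)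
    carry-below ℓ 1+ℓ≤t = carry-at ℓ j (∣-trans (^-∣-^ P s+1+ℓ≤v) P^v∣j) M<j j≤N
      where
      s+1+ℓ≤v : s + suc ℓ ≤ v
      s+1+ℓ≤v = subst (s + suc ℓ ≤_) (m+[n∸m]≡n s≤v) (+-monoʳ-≤ s 1+ℓ≤t)
    inD : ∀ ℓ → 1 ≤ ℓ → ℓ ≤ v ∸ s → InD e f (fracVec m P ℓ)
    inD (suc ℓ) _ 1+ℓ≤t = proj₁ (carry-below ℓ 1+ℓ≤t)
    below-bound : ∀ t → t ≤ v ∸ s → t ≤ muBound e f m
    below-bound zero    _      = z≤n
    below-bound (suc ℓ) 1+ℓ≤t = ≤-trans (<⇒≤ (n<P^n P 1<P (suc ℓ))) (proj₂ (carry-below ℓ 1+ℓ≤t))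

  C : ℕ
  C = P ^ suc s * g e f P m

  C≡P^[1+s+μ] : C ≡ P ^ suc (s + μ e f P m)
  C≡P^[1+s+μ] = sym (^-distribˡ-+-* P (suc s) (μ e f P m))

  -- Each term C / (1 + i) of the window lies in pℤ_(P): factor 1 + i as
  -- P^v (1 + u) with P ∤ 1 + u and bound v by the valuation bound.
  window-term : ∀ i → M ≤ i → i < N → PMultiple P ((+ C ℚ./ 1) ℚ.* (+ 1 ℚ./ suc i))
  window-term i M≤i i<N = fromFactorisation (factorise P 1<P i)
    where
    fromFactorisation : Factorisation P i → PMultiple P ((+ C ℚ./ 1) ℚ.* (+ 1 ℚ./ suc i))
    fromFactorisation (v , u , 1+i≡ , P∤1+u) =
      pMultiple-power-quot C (s + μ e f P m) i v u C≡P^[1+s+μ] 1+i≡ P∤1+u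
        (valuation-bound v (suc i) (divides (suc u) (trans 1+i≡ (*-comm (P ^ v) (suc u)))) (s≤s M≤i) i<N)

  window-pMultiple : PMultiple P ((+ C ℚ./ 1) ℚ.* (H N ℚ.- H M))
  window-pMultiple =
    subst (λ n → PMultiple P ((+ C ℚ./ 1) ℚ.* (H n ℚ.- H M))) (m+[n∸m]≡n M≤N)
      (pMultiple-harmonic P-prime (+ C ℚ./ 1) M (N ∸ M)
        (λ i M≤i i<M+[N∸M] → window-term i M≤i (subst (i <_) (m+[n∸m]≡n M≤N) i<M+[N∸M])))

  -- The theorem for this window, with ⌊m/P⌋ written as in the statement.  The
  -- rational r is passed explicitly so that no unification has to look inside
  -- the normalised rational arithmetic.
  theorem : InPZp P ((+ (P ^ suc s * g e f P m) ℚ./ 1) ℚ.*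
                     (H (dotℕ L m * P ^ s) ℚ.- H (dotℕ L (λ k → m k /ℕ P) * P ^ suc s)))
  theorem =
    subst (λ x → InPZp P ((+ C ℚ./ 1) ℚ.* (H N ℚ.- H (x * P ^ suc s))))
          (dot-congʳ L (λ k → sym (/ℕ-is-/ (m k) P)))
          (pMultiple⇒InPZp {r = (+ C ℚ./ 1) ℚ.* (H N ℚ.- H M)} P-prime window-pMultiple)

-- The theorem is the window statement for P = p.
lemma9 : (d : ℕ) (e f : List (Vecℕ d)) →
    All NonZeroVec e → All NonZeroVec f →
    (∀ {u v} → u ∈ e → v ∈ f → DistinctVec u v) →
    normSeq e ≡ normSeq f →
    (∀ (x : Vecℚ d) → InClosedCube x → + 0 ℤ.≤ Δ e f x) →
    (∀ (x : Vecℚ d) → InD e f x → + 1 ℤ.≤ Δ e f x) →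
    ∀ (p : ℕ) → Prime p →
    ∀ (L : Vecℕ d) → InE e f L →
    ∀ (m : Vecℕ d) (s : ℕ) →
    InPZp p
      (((+ (p ℕ.^ suc s ℕ.* g e f p m)) ℚ./ 1) ℚ.*
        (H (dotℕ L m ℕ.* p ℕ.^ s)
          ℚ.- H (dotℕ L (λ k → m k /ℕ p) ℕ.* p ℕ.^ suc s)))
lemma9 d e f _ _ _ _ _ _ p p-prime L L∈E m s = Window.theorem e f L L∈E p p-prime m s
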